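{- Fix a time $t$ in the rate-assignment algorithm described in the context, let $\tau$ be a moment, let $V$ be the set of alive tasks frozen at or before moment $\tau$, and let $v\in V$. Then: (i) if $V'\subseteq V$ is any set of tasks each of which freezes at the same moment as $v$ or after it, then $\frac{\tilde w^t(v)}{s_{|V|}}\ge\frac{w(V')}{S_{|V|}}$; (ii) if $V''\subseteq V$ is any set of tasks each of which freezes at the same moment as $v$ or before it, then $\frac{\tilde w^t(v)}{L^t_v}\le\frac{\tilde w^t(V'')}{\sum_{v'\in V''}L^t_{v'}}$.
   Context: Machines have speeds $s_1\ge\dots\ge s_m>0$ and $S_k=s_1+\dots+s_k$. Each job $j$ has weight $w_j>0$ and a set of tasks; $T^t(j)$ is the set of alive tasks of $j$ at time $t$. For an alive task $v\in T^t(j)$, $\tilde w^t(v):=w_j/|T^t(j)|$, and $\tilde w^t(X)=\sum_{v\in X}\tilde w^t(v)$ for a set $X$ of alive tasks; $w(X)$ denotes the total weight of the jobs having at least one task in $X$. Rate assignment at time $t$ with parameter $\gamma\ge1$: raise a parameter $\tau$ (values called moments) from $0$; each unfrozen alive task $v\in T^t(j)$ has tentative rate $L^t_v=\tilde w^t(v)\tau$. Whenever some subset $V$ of alive tasks satisfies $\sum_{u\in V}L^t_u=\gamma S_{|V|}$, a maximal such set is frozen (rates fixed); continue until all alive tasks are frozen. The rates always satisfy $\sum_{u\in V}L^t_u\le\gamma S_{|V|}$ for every set $V$ of alive tasks, and a task frozen at moment $\tau_v$ has rate $L^t_v=\tilde w^t(v)\tau_v$.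
   Formalization: The machine speeds, the job weights, the parameter γ and all moments, including τ, take values in ℚ. -}

module Defs where

open import Data.Nat as ℕ using (ℕ; zero; suc; NonZero)
open import Data.Fin using (Fin; zero; suc; fromℕ<)
open import Data.Fin.Properties using (any?)
open import Data.Fin.Subset using (Subset; _∈_; _⊆_; ∣_∣)
open import Data.Fin.Subset.Properties using (_∈?_)
open import Data.Bool using (Bool; true; false; if_then_else_)
open import Data.Integer using (+_)
open import Data.Rational using (ℚ; 0ℚ; 1ℚ; _+_; _*_; _⊓_; _≤_; _<_; _/_)
open import Data.Product using (_×_; ∃; _,_)
open import Relation.Nullary.Decidable using (⌊_⌋; _×-dec_)
open import Relation.Binary.PropositionalEquality using (_≡_; refl)
open import Relation.Nullary using (yes; no)
open import Data.Empty using (⊥-elim)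
open import Data.Vec using (tabulate)
open import Data.Rational.Properties using (_≤?_)

Σ : ∀ {n} → (Fin n → ℚ) → ℚ
Σ {zero}  f = 0ℚ
Σ {suc n} f = f zero + Σ (λ i → f (suc i))

Σ[_] : ∀ {n} → Subset n → (Fin n → ℚ) → ℚ
Σ[ X ] f = Σ (λ u → if ⌊ u ∈? X ⌋ then f u else 0ℚ)

count : ∀ {n} → (Fin n → Bool) → ℕ
count {zero}  p = 0
count {suc n} p = (if p zero then 1 else 0) ℕ.+ count (λ i → p (suc i))

count-nonZero : ∀ {n} (p : Fin n → Bool) (v : Fin n) → p v ≡ true → NonZero (count p)
count-nonZero p zero eq rewrite eq = _
count-nonZero p (suc v) eq with p zero
... | true  = _
... | false = count-nonZero (λ i → p (suc i)) v eq

-- Machines: speeds s_1 ≥ … ≥ s_m > 0, given as s : Fin m → ℚ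
-- (s zero is s_1).  Convention: s_k = 0 for k > m (and for k = 0).

SpeedsOK : ∀ {m} → (Fin m → ℚ) → Set
SpeedsOK {m} s = (∀ i → 0ℚ < s i) × (∀ (i j : Fin m) → Data.Fin._≤_ i j → s j ≤ s i)

spd : ∀ {m} → (Fin m → ℚ) → ℕ → ℚ
spd s zero = 0ℚ
spd {m} s (suc i) with i ℕ.<? m
... | yes i<m = s (fromℕ< i<m)
... | no  _   = 0ℚ

Ssum : ∀ {m} → (Fin m → ℚ) → ℕ → ℚ
Ssum s zero    = 0ℚ
Ssum s (suc k) = Ssum s k + spd s (suc k)

-- Snapshot at time t: n alive tasks (Fin n), J jobs with weights w,
-- job : Fin n → Fin J says to which job each alive task belongs.

sameJob : ∀ {n J} → (Fin n → Fin J) → Fin n → Fin n → Bool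
sameJob job v u = ⌊ job u Data.Fin.≟ job v ⌋

sameJob-refl : ∀ {n J} (job : Fin n → Fin J) (v : Fin n) → sameJob job v v ≡ true
sameJob-refl job v with job v Data.Fin.≟ job v
... | yes _ = refl
... | no ¬p = ⊥-elim (¬p refl)

numAlive : ∀ {n J} → (Fin n → Fin J) → Fin n → ℕ
numAlive job v = count (sameJob job v)

wt : ∀ {n J} → (Fin J → ℚ) → (Fin n → Fin J) → Fin n → ℚ
wt w job v = w (job v) * (_/_ (+ 1) (numAlive job v)
               {{count-nonZero (sameJob job v) v (sameJob-refl job v)}})

wtSet : ∀ {n J} → (Fin J → ℚ) → (Fin n → Fin J) → Subset n → ℚ
wtSet w job X = Σ[ X ] (wt w job)

wSet : ∀ {n J} → (Fin J → ℚ) → (Fin n → Fin J) → Subset n → ℚ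
wSet w job X =
  Σ (λ j → if ⌊ any? (λ u → (u ∈? X) ×-dec (job u Data.Fin.≟ j)) ⌋ then w j else 0ℚ)

-- A run of the rate-assignment algorithm at time t is described by the
-- freezing moment φ u of every alive task u.  At moment τ the (tentative or
-- frozen) rate of u is  w̃(u) · min(φ u, τ).

rateAt : ∀ {n J} → (Fin J → ℚ) → (Fin n → Fin J) → (Fin n → ℚ) → ℚ → Fin n → ℚ
rateAt w job φ τ u = wt w job u * (φ u ⊓ τ)

rate : ∀ {n J} → (Fin J → ℚ) → (Fin n → Fin J) → (Fin n → ℚ) → Fin n → ℚ
rate w job φ u = wt w job u * φ u

-- φ is the outcome of the algorithm with parameter γ:
--  * moments are ≥ 0 (τ is raised from 0);
--  * at every moment τ ≥ 0 no set V of alive tasks has total rate exceeding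
--    γ S_|V|  (whenever a set becomes tight it is frozen);
--  * every task u is frozen at moment φ u because it belongs to a set V
--    that is tight at that moment:  Σ_{V} L_u = γ S_|V|.
IsRun : ∀ {m n J} → (Fin m → ℚ) → (Fin J → ℚ) → (Fin n → Fin J) → ℚ → (Fin n → ℚ) → Set
IsRun {m} {n} s w job γ φ =
    (∀ u → 0ℚ ≤ φ u)
  × (∀ (τ : ℚ) → 0ℚ ≤ τ → ∀ (V : Subset n) →
       Σ[ V ] (rateAt w job φ τ) ≤ γ * Ssum s ∣ V ∣)
  × (∀ (u : Fin n) → ∃ λ (V : Subset n) →
       u ∈ V × Σ[ V ] (rateAt w job φ (φ u)) ≡ γ * Ssum s ∣ V ∣)

frozenBy : ∀ {n} → (Fin n → ℚ) → ℚ → Subset n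
frozenBy φ τ = tabulate (λ u → ⌊ φ u ≤? τ ⌋)

{-# OPTIONS --safe #-}

-- Call X tight at moment μ when its rates at μ, L_μ(u) = w̃(u) min(φ u, μ), sum to γ S_|X|.
-- Rates only grow with μ, so every member u of a set tight at μ has φ u ≤ μ: otherwise X
-- would violate feasibility at moment φ u.  Tasks of one job have the same w̃, so exchanging
-- one for another in a tight set keeps it tight; hence all alive tasks of a job freeze at
-- the same moment.
--
-- (i) Let X be the tight set freezing v.  It lies in V, and comparing it with the feasible
-- set X ∖ {v} gives γ s_|X| ≤ L_v, hence γ s_|V| ≤ L_v as speeds decrease.  The alive tasks
-- of the jobs meeting V′ form a set C ⊆ V whose rates at moment τ add up to at least
-- w(V′) φ(v), so w(V′) φ(v) ≤ γ S_|C| ≤ γ S_|V|.  Hence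
-- γ w(V′) s_|V| ≤ w(V′) w̃(v) φ(v) ≤ γ w̃(v) S_|V|, and γ cancels.
-- (ii) holds termwise: w̃(v) L_u = w̃(v) w̃(u) φ(u) ≤ w̃(u) L_v.

module Submission where

open import Defs
open import Algebra.Bundles using (CommutativeMonoid)
import Algebra.Properties.CommutativeMonoid.Sum as MonoidSum
import Algebra.Properties.CommutativeSemigroup as CommSemigroupProperties
open import Data.Bool using (Bool; true; false; if_then_else_; T)
open import Data.Bool.Properties using (T-≡)
open import Data.Empty using (⊥-elim)
open import Data.Fin using (Fin; zero; suc; fromℕ<; _≟_)
open import Data.Fin.Properties using (toℕ-fromℕ<; any?)
open import Data.Fin.Subset using (Subset; inside; outside; _∈_; _∉_; _⊆_; ∣_∣)
open import Data.Fin.Subset.Properties using (_∈?_; p⊆q⇒∣p∣≤∣q∣)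
import Data.Integer as ℤ
import Data.Integer.Properties as ℤ
open import Data.Nat as ℕ using (zero; suc; NonZero; s≤s)
import Data.Nat.Properties as ℕ
open import Data.Product using (_×_; _,_; ∃; proj₁; proj₂)
open import Data.Rational using (ℚ; 1/_; 0ℚ; 1ℚ; _+_; _*_; _≤_; _<_; _/_; positive; nonNegative)
open import Data.Rational.Literals using (fromℤ)
open import Data.Rational.Properties hiding (_≟_)
open import Data.Vec using (_∷_; lookup; _[_]≔_; tabulate; here; there)
open import Data.Vec.Properties
  using ([]=-injective; []=⇒lookup; lookup⇒[]=; lookup∘tabulate; []≔-idempotent; []≔-lookup; []≔-updates)
open import Function using (_∘_; Equivalence)
open import Relation.Binary.PropositionalEquality
open import Relation.Nullary using (Dec; yes; no; ¬_)
open import Relation.Nullary.Decidable using (⌊_⌋; _×-dec_; toWitness; fromWitness; ⌊⌋-map′)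

open MonoidSum +-0-commutativeMonoid using (sum; sum-cong-≗; ∑-comm)
open CommSemigroupProperties (CommutativeMonoid.commutativeSemigroup +-0-commutativeMonoid)
  using () renaming (x∙yz≈y∙xz to x+[y+z]≡y+[x+z])
open CommSemigroupProperties (CommutativeMonoid.commutativeSemigroup *-1-commutativeMonoid)
  using () renaming (x∙yz≈y∙xz to x*[y*z]≡y*[x*z])

Σ-cong : ∀ {n} {f g : Fin n → ℚ} → (∀ i → f i ≡ g i) → Σ f ≡ Σ g
Σ-cong {zero}  f≗g = refl
Σ-cong {suc n} f≗g = cong₂ _+_ (f≗g zero) (Σ-cong (f≗g ∘ suc))

Σ-mono-≤ : ∀ {n} {f g : Fin n → ℚ} → (∀ i → f i ≤ g i) → Σ f ≤ Σ g
Σ-mono-≤ {zero}  f≤g = ≤-refl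
Σ-mono-≤ {suc n} f≤g = +-mono-≤ (f≤g zero) (Σ-mono-≤ (f≤g ∘ suc))

Σ-nonNeg : ∀ {n} {f : Fin n → ℚ} → (∀ i → 0ℚ ≤ f i) → 0ℚ ≤ Σ f
Σ-nonNeg {zero}  f≥0 = ≤-refl
Σ-nonNeg {suc n} f≥0 = +-mono-≤ (f≥0 zero) (Σ-nonNeg (f≥0 ∘ suc))

Σ-zero : ∀ n → Σ {n} (λ _ → 0ℚ) ≡ 0ℚ
Σ-zero zero    = refl
Σ-zero (suc n) = trans (+-identityˡ _) (Σ-zero n)

*-distribˡ-Σ : ∀ {n} c (f : Fin n → ℚ) → c * Σ f ≡ Σ (λ i → c * f i)
*-distribˡ-Σ {zero}  c f = *-zeroʳ c
*-distribˡ-Σ {suc n} c f =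
  trans (*-distribˡ-+ c (f zero) (Σ (f ∘ suc))) (cong ((c * f zero) +_) (*-distribˡ-Σ c (f ∘ suc)))

Σ≡sum : ∀ {n} (f : Fin n → ℚ) → Σ f ≡ sum f
Σ≡sum {zero}  f = refl
Σ≡sum {suc n} f = cong (f zero +_) (Σ≡sum (f ∘ suc))

Σ-comm : ∀ {m n} (F : Fin m → Fin n → ℚ) → Σ (λ i → Σ (F i)) ≡ Σ (λ j → Σ (λ i → F i j))
Σ-comm F = begin
  Σ (λ i → Σ (F i))              ≡⟨ Σ≡sum (λ i → Σ (F i)) ⟩
  sum (λ i → Σ (F i))            ≡⟨ sum-cong-≗ (Σ≡sum ∘ F) ⟩
  sum (λ i → sum (F i))          ≡⟨ ∑-comm F ⟩
  sum (λ j → sum (λ i → F i j))  ≡⟨ sum-cong-≗ (λ j → sym (Σ≡sum (λ i → F i j))) ⟩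
  sum (λ j → Σ (λ i → F i j))    ≡⟨ sym (Σ≡sum (λ j → Σ (λ i → F i j))) ⟩
  Σ (λ j → Σ (λ i → F i j))      ∎
  where open ≡-Reasoning

Σ-δ : ∀ {n} (k : Fin n) (g : Fin n → ℚ) → Σ (λ j → if ⌊ k ≟ j ⌋ then g j else 0ℚ) ≡ g k
Σ-δ {suc n} zero    g = trans (cong (g zero +_) (Σ-zero n)) (+-identityʳ (g zero))
Σ-δ {suc n} (suc k) g = begin
  0ℚ + Σ (λ j → if ⌊ suc k ≟ suc j ⌋ then g (suc j) else 0ℚ)  ≡⟨ +-identityˡ _ ⟩
  Σ (λ j → if ⌊ suc k ≟ suc j ⌋ then g (suc j) else 0ℚ)       ≡⟨ Σ-cong unshift ⟩
  Σ (λ j → if ⌊ k ≟ j ⌋ then g (suc j) else 0ℚ)               ≡⟨ Σ-δ k (g ∘ suc) ⟩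
  g (suc k)                                                    ∎
  where
  open ≡-Reasoning
  unshift : ∀ j → (if ⌊ suc k ≟ suc j ⌋ then g (suc j) else 0ℚ) ≡ (if ⌊ k ≟ j ⌋ then g (suc j) else 0ℚ)
  unshift j = cong (λ b → if b then g (suc j) else 0ℚ) (⌊⌋-map′ _ _ (k ≟ j))

Σ-fibres : ∀ {n J} (π : Fin n → Fin J) (g : Fin n → ℚ) →
           Σ (λ j → Σ (λ u → if ⌊ π u ≟ j ⌋ then g u else 0ℚ)) ≡ Σ g
Σ-fibres π g =
  trans (Σ-comm (λ j u → if ⌊ π u ≟ j ⌋ then g u else 0ℚ)) (Σ-cong (λ u → Σ-δ (π u) (λ _ → g u)))

-- 1ℚ + fromℤ (+ k) computes to (+ 1 ℤ.+ + k ℤ.* + 1) / 1.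
fromℤ-suc : ∀ k → fromℤ (ℤ.+ suc k) ≡ 1ℚ + fromℤ (ℤ.+ k)
fromℤ-suc k = trans (sym (↥p/↧p≡p (fromℤ (ℤ.+ suc k))))
                    (cong (λ i → (ℤ.+ 1 ℤ.+ i) / 1) (sym (ℤ.*-identityʳ (ℤ.+ k))))

-- The normal form of + 1 / n is 1/ fromℤ (+ n).
1/n*n≡1 : ∀ n .{{_ : NonZero n}} → (ℤ.+ 1 / n) * fromℤ (ℤ.+ n) ≡ 1ℚ
1/n*n≡1 (suc k) = trans (cong (_* fromℤ (ℤ.+ suc k)) (↥p/↧p≡p (1/ fromℤ (ℤ.+ suc k))))
                        (*-inverseˡ (fromℤ (ℤ.+ suc k)))

1/n-cong : ∀ {c d} .{{_ : NonZero c}} .{{_ : NonZero d}} → c ≡ d → ℤ.+ 1 / c ≡ ℤ.+ 1 / d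
1/n-cong refl = refl

Σ-count : ∀ {n} (p : Fin n → Bool) → Σ (λ u → if p u then 1ℚ else 0ℚ) ≡ fromℤ (ℤ.+ count p)
Σ-count {zero}  p = refl
Σ-count {suc n} p with p zero
... | true  = trans (cong (1ℚ +_) (Σ-count (p ∘ suc))) (sym (fromℤ-suc _))
... | false = trans (+-identityˡ _) (Σ-count (p ∘ suc))

if-mono-≤ : ∀ {P : Set} (P? : Dec P) {x y : ℚ} → (P → x ≤ y) →
            (if ⌊ P? ⌋ then x else 0ℚ) ≤ (if ⌊ P? ⌋ then y else 0ℚ)
if-mono-≤ (yes p) x≤y = x≤y p
if-mono-≤ (no _)  x≤y = ≤-refl

if-nonNeg : ∀ b {x} → 0ℚ ≤ x → 0ℚ ≤ (if b then x else 0ℚ)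
if-nonNeg true  x≥0 = x≥0
if-nonNeg false x≥0 = ≤-refl

if-dec-yes : ∀ {P : Set} (P? : Dec P) {x y : ℚ} → P → (if ⌊ P? ⌋ then x else y) ≡ x
if-dec-yes (yes _) p = refl
if-dec-yes (no ¬p) p = ⊥-elim (¬p p)

*-distribˡ-if : ∀ b c x → c * (if b then x else 0ℚ) ≡ (if b then c * x else 0ℚ)
*-distribˡ-if true  c x = refl
*-distribˡ-if false c x = *-zeroʳ c

Σ[]-∷ : ∀ {n} b (X : Subset n) (f : Fin (suc n) → ℚ) →
        Σ[ b ∷ X ] f ≡ (if b then f zero else 0ℚ) + Σ[ X ] (f ∘ suc)
Σ[]-∷ b X f = cong₂ _+_ (head b) (Σ-cong tail)
  where
  tail : ∀ i → (if ⌊ suc i ∈? b ∷ X ⌋ then f (suc i) else 0ℚ) ≡ (if ⌊ i ∈? X ⌋ then f (suc i) else 0ℚ)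
  tail i = cong (λ c → if c then f (suc i) else 0ℚ) (⌊⌋-map′ _ _ (i ∈? X))
  head : ∀ b → (if ⌊ zero ∈? b ∷ X ⌋ then f zero else 0ℚ) ≡ (if b then f zero else 0ℚ)
  head inside  = refl
  head outside = refl

Σ[]-mono-≤ : ∀ {n} (X : Subset n) {f g : Fin n → ℚ} → (∀ {u} → u ∈ X → f u ≤ g u) → Σ[ X ] f ≤ Σ[ X ] g
Σ[]-mono-≤ X f≤g = Σ-mono-≤ (λ u → if-mono-≤ (u ∈? X) f≤g)

*-distribˡ-Σ[] : ∀ {n} (X : Subset n) c (f : Fin n → ℚ) → c * Σ[ X ] f ≡ Σ[ X ] (λ u → c * f u)
*-distribˡ-Σ[] {n} X c f = trans (*-distribˡ-Σ {n} c _) (Σ-cong (λ u → *-distribˡ-if ⌊ u ∈? X ⌋ c (f u)))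

Σ[]-insert : ∀ {n} {X : Subset n} {u} (f : Fin n → ℚ) → u ∉ X → Σ[ X [ u ]≔ inside ] f ≡ f u + Σ[ X ] f
Σ[]-insert {X = outside ∷ X} {zero} f u∉X = begin
  Σ[ inside ∷ X ] f                    ≡⟨ Σ[]-∷ inside X f ⟩
  f zero + Σ[ X ] (f ∘ suc)            ≡⟨ cong (f zero +_) (sym (+-identityˡ _)) ⟩
  f zero + (0ℚ + Σ[ X ] (f ∘ suc))     ≡⟨ cong (f zero +_) (sym (Σ[]-∷ outside X f)) ⟩
  f zero + Σ[ outside ∷ X ] f          ∎
  where open ≡-Reasoning
Σ[]-insert {X = inside ∷ X} {zero} f u∉X = ⊥-elim (u∉X here)
Σ[]-insert {X = b ∷ X} {suc u} f u∉X = begin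
  Σ[ b ∷ (X [ u ]≔ inside) ] f                ≡⟨ Σ[]-∷ b _ f ⟩
  f₀ + Σ[ X [ u ]≔ inside ] (f ∘ suc)          ≡⟨ cong (f₀ +_) (Σ[]-insert (f ∘ suc) (u∉X ∘ there)) ⟩
  f₀ + (f (suc u) + Σ[ X ] (f ∘ suc))          ≡⟨ x+[y+z]≡y+[x+z] f₀ (f (suc u)) (Σ[ X ] (f ∘ suc)) ⟩
  f (suc u) + (f₀ + Σ[ X ] (f ∘ suc))          ≡⟨ cong (f (suc u) +_) (sym (Σ[]-∷ b X f)) ⟩
  f (suc u) + Σ[ b ∷ X ] f                     ∎
  where
  open ≡-Reasoning
  f₀ = if b then f zero else 0ℚ

∣insert∣ : ∀ {n} {X : Subset n} {u} → u ∉ X → ∣ X [ u ]≔ inside ∣ ≡ suc ∣ X ∣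
∣insert∣ {X = outside ∷ X} {zero}  u∉X = refl
∣insert∣ {X = inside ∷ X}  {zero}  u∉X = ⊥-elim (u∉X here)
∣insert∣ {X = outside ∷ X} {suc u} u∉X = ∣insert∣ (u∉X ∘ there)
∣insert∣ {X = inside ∷ X}  {suc u} u∉X = cong suc (∣insert∣ (u∉X ∘ there))

erase-⊆ : ∀ {n} (X : Subset n) u → X [ u ]≔ outside ⊆ X
erase-⊆ (b ∷ X) zero    (there v∈X) = there v∈X
erase-⊆ (b ∷ X) (suc u) here        = here
erase-⊆ (b ∷ X) (suc u) (there v∈X) = there (erase-⊆ X u v∈X)

∉-erase : ∀ {n} (X : Subset n) u → u ∉ X [ u ]≔ outside
∉-erase X u u∈ with []=-injective u∈ ([]≔-updates X u)
... | ()

insert-erase : ∀ {n} {X : Subset n} {u} → u ∈ X → (X [ u ]≔ outside) [ u ]≔ inside ≡ X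
insert-erase {X = X} {u} u∈X = begin
  (X [ u ]≔ outside) [ u ]≔ inside ≡⟨ []≔-idempotent X u ⟩
  X [ u ]≔ inside                  ≡⟨ cong (X [ u ]≔_) (sym ([]=⇒lookup u∈X)) ⟩
  X [ u ]≔ lookup X u              ≡⟨ []≔-lookup X u ⟩
  X                                ∎
  where open ≡-Reasoning

Σ[]-erase : ∀ {n} {X : Subset n} {u} (f : Fin n → ℚ) → u ∈ X → Σ[ X ] f ≡ f u + Σ[ X [ u ]≔ outside ] f
Σ[]-erase {X = X} {u} f u∈X =
  trans (cong (λ Y → Σ[ Y ] f) (sym (insert-erase u∈X))) (Σ[]-insert f (∉-erase X u))

∣erase∣ : ∀ {n} {X : Subset n} {u} → u ∈ X → ∣ X ∣ ≡ suc ∣ X [ u ]≔ outside ∣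
∣erase∣ {X = X} {u} u∈X = trans (cong ∣_∣ (sym (insert-erase u∈X))) (∣insert∣ (∉-erase X u))

Σ[]-exchange : ∀ {n} {X : Subset n} {u u′} (f : Fin n → ℚ) → u ∈ X → u′ ∉ X → f u′ ≡ f u →
               Σ[ (X [ u ]≔ outside) [ u′ ]≔ inside ] f ≡ Σ[ X ] f
Σ[]-exchange {X = X} {u} f u∈X u′∉X fu′≡fu = begin
  Σ[ (X [ u ]≔ outside) [ _ ]≔ inside ] f ≡⟨ Σ[]-insert f (u′∉X ∘ erase-⊆ X u) ⟩
  f _ + Σ[ X [ u ]≔ outside ] f           ≡⟨ cong (_+ Σ[ X [ u ]≔ outside ] f) fu′≡fu ⟩
  f u + Σ[ X [ u ]≔ outside ] f           ≡⟨ sym (Σ[]-erase f u∈X) ⟩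
  Σ[ X ] f                                ∎
  where open ≡-Reasoning

∣exchange∣ : ∀ {n} {X : Subset n} {u u′} → u ∈ X → u′ ∉ X → ∣ (X [ u ]≔ outside) [ u′ ]≔ inside ∣ ≡ ∣ X ∣
∣exchange∣ {X = X} {u} u∈X u′∉X = trans (∣insert∣ (u′∉X ∘ erase-⊆ X u)) (sym (∣erase∣ u∈X))

Σ[]-mono-< : ∀ {n} {X : Subset n} {u} {f g : Fin n → ℚ} → u ∈ X →
             (∀ {x} → x ∈ X → f x ≤ g x) → f u < g u → Σ[ X ] f < Σ[ X ] g
Σ[]-mono-< {X = X} {u} {f} {g} u∈X f≤g fu<gu = begin-strict
  Σ[ X ] f                              ≡⟨ Σ[]-erase f u∈X ⟩
  f u + Σ[ X [ u ]≔ outside ] f         <⟨ +-mono-<-≤ fu<gu (Σ[]-mono-≤ (X [ u ]≔ outside) (f≤g ∘ erase-⊆ X u)) ⟩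
  g u + Σ[ X [ u ]≔ outside ] g         ≡⟨ sym (Σ[]-erase g u∈X) ⟩
  Σ[ X ] g                              ∎
  where open ≤-Reasoning

∈-tabulate⁻ : ∀ {n} (p : Fin n → Bool) {u} → u ∈ tabulate p → T (p u)
∈-tabulate⁻ p {u} u∈ = Equivalence.from T-≡ (trans (sym (lookup∘tabulate p u)) ([]=⇒lookup u∈))

∈-tabulate⁺ : ∀ {n} (p : Fin n → Bool) {u} → T (p u) → u ∈ tabulate p
∈-tabulate⁺ p {u} pu = lookup⇒[]= u (tabulate p) (trans (lookup∘tabulate p u) (Equivalence.to T-≡ pu))

∈-frozenBy⁻ : ∀ {n} {φ : Fin n → ℚ} {τ u} → u ∈ frozenBy φ τ → φ u ≤ τ
∈-frozenBy⁻ {φ = φ} {τ} u∈F = toWitness (∈-tabulate⁻ (λ x → ⌊ φ x ≤? τ ⌋) u∈F)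

∈-frozenBy⁺ : ∀ {n} {φ : Fin n → ℚ} {τ u} → φ u ≤ τ → u ∈ frozenBy φ τ
∈-frozenBy⁺ {φ = φ} {τ} φu≤τ = ∈-tabulate⁺ (λ x → ⌊ φ x ≤? τ ⌋) (fromWitness φu≤τ)

<⇒≱ : ∀ {p q : ℚ} → p < q → ¬ (q ≤ p)
<⇒≱ p<q q≤p = <-irrefl refl (<-≤-trans p<q q≤p)

+-cancelʳ-≤ : ∀ r {p q} → p + r ≤ q + r → p ≤ q
+-cancelʳ-≤ r p+r≤q+r = ≮⇒≥ (λ q<p → <⇒≱ (+-monoˡ-< r q<p) p+r≤q+r)

module _ {m} {s : Fin m → ℚ} (speeds : SpeedsOK s) where

  spd-nonNeg : ∀ k → 0ℚ ≤ spd s k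
  spd-nonNeg zero    = ≤-refl
  spd-nonNeg (suc i) with i ℕ.<? m
  ... | yes i<m = <⇒≤ (proj₁ speeds (fromℕ< i<m))
  ... | no  _   = ≤-refl

  spd-antitone : ∀ {i j} → suc i ℕ.≤ j → spd s j ≤ spd s (suc i)
  spd-antitone {i} {suc j} (s≤s i≤j) with j ℕ.<? m
  ... | no  _   = spd-nonNeg (suc i)
  ... | yes j<m with i ℕ.<? m
  ...   | yes i<m = proj₂ speeds (fromℕ< i<m) (fromℕ< j<m)
                      (subst₂ ℕ._≤_ (sym (toℕ-fromℕ< i<m)) (sym (toℕ-fromℕ< j<m)) i≤j)
  ...   | no  i≮m = ⊥-elim (i≮m (ℕ.≤-<-trans i≤j j<m))

  Ssum-mono : ∀ {a b} → a ℕ.≤ b → Ssum s a ≤ Ssum s b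
  Ssum-mono = mono′ ∘ ℕ.≤⇒≤′
    where
    Ssum≤Ssum-suc : ∀ b → Ssum s b ≤ Ssum s (suc b)
    Ssum≤Ssum-suc b =
      subst (_≤ Ssum s (suc b)) (+-identityʳ (Ssum s b)) (+-monoʳ-≤ (Ssum s b) (spd-nonNeg (suc b)))
    mono′ : ∀ {a b} → a ℕ.≤′ b → Ssum s a ≤ Ssum s b
    mono′ ℕ.≤′-refl         = ≤-refl
    mono′ (ℕ.≤′-step {b} h) = ≤-trans (mono′ h) (Ssum≤Ssum-suc b)

numAlive-nonZero : ∀ {n J} (job : Fin n → Fin J) v → NonZero (numAlive job v)
numAlive-nonZero job v = count-nonZero (sameJob job v) v (sameJob-refl job v)

meets? : ∀ {n J} (job : Fin n → Fin J) (V : Subset n) j → Dec (∃ λ u → u ∈ V × job u ≡ j)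
meets? job V j = any? (λ u → (u ∈? V) ×-dec (job u ≟ j))

jobClosure : ∀ {n J} → (Fin n → Fin J) → Subset n → Subset n
jobClosure job V = tabulate (λ u → ⌊ meets? job V (job u) ⌋)

∈-jobClosure⁻ : ∀ {n J} {job : Fin n → Fin J} {V u} → u ∈ jobClosure job V → ∃ λ u′ → u′ ∈ V × job u′ ≡ job u
∈-jobClosure⁻ {job = job} {V} u∈ = toWitness (∈-tabulate⁻ (λ x → ⌊ meets? job V (job x) ⌋) u∈)

∈-jobClosure⁺ : ∀ {n J} {job : Fin n → Fin J} {V u u′} → u′ ∈ V → job u′ ≡ job u → u ∈ jobClosure job V
∈-jobClosure⁺ {job = job} {V} u′∈V same = ∈-tabulate⁺ (λ x → ⌊ meets? job V (job x) ⌋) (fromWitness (_ , u′∈V , same))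

module _ {n J} {w : Fin J → ℚ} {job : Fin n → Fin J} where

  wt-sameJob : ∀ {u x} → job u ≡ job x → wt w job u ≡ wt w job x
  wt-sameJob {u} {x} ju≡jx = cong₂ _*_ (cong w ju≡jx)
    (1/n-cong {{numAlive-nonZero job u}} {{numAlive-nonZero job x}}
      (cong (λ j → count (λ y → ⌊ job y ≟ j ⌋)) ju≡jx))

  Σ-wt-job : ∀ u → Σ (λ x → if ⌊ job x ≟ job u ⌋ then wt w job x else 0ℚ) ≡ w (job u)
  Σ-wt-job u = begin
    Σ (λ x → if ⌊ job x ≟ job u ⌋ then wt w job x else 0ℚ)   ≡⟨ Σ-cong (λ x → factor (job x ≟ job u)) ⟩
    Σ (λ x → wt w job u * indicator x)                        ≡⟨ sym (*-distribˡ-Σ (wt w job u) indicator) ⟩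
    wt w job u * Σ indicator                                  ≡⟨ cong (wt w job u *_) (Σ-count (sameJob job u)) ⟩
    wt w job u * fromℤ (ℤ.+ c)                                ≡⟨ *-assoc (w (job u)) _ _ ⟩
    w (job u) * ((ℤ.+ 1 / c) * fromℤ (ℤ.+ c))                 ≡⟨ cong (w (job u) *_) (1/n*n≡1 c) ⟩
    w (job u) * 1ℚ                                            ≡⟨ *-identityʳ (w (job u)) ⟩
    w (job u)                                                 ∎
    where
    open ≡-Reasoning
    c = numAlive job u
    instance _ = numAlive-nonZero job u
    indicator : Fin n → ℚ
    indicator x = if ⌊ job x ≟ job u ⌋ then 1ℚ else 0ℚ
    factor : ∀ {x} (d : Dec (job x ≡ job u)) →
             (if ⌊ d ⌋ then wt w job x else 0ℚ) ≡ wt w job u * (if ⌊ d ⌋ then 1ℚ else 0ℚ)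
    factor (yes jx≡ju) = trans (wt-sameJob jx≡ju) (sym (*-identityʳ _))
    factor (no _)      = sym (*-zeroʳ (wt w job u))

  wSet*≤Σ[jobClosure] : ∀ V μ (g : Fin n → ℚ) → (∀ u → 0ℚ ≤ g u) →
                        (∀ {u} → u ∈ jobClosure job V → wt w job u * μ ≤ g u) →
                        wSet w job V * μ ≤ Σ[ jobClosure job V ] g
  wSet*≤Σ[jobClosure] V μ g g≥0 bound = begin
    wSet w job V * μ
      ≡⟨ *-comm (wSet w job V) μ ⟩
    μ * wSet w job V
      ≡⟨ *-distribˡ-Σ μ (λ j → if ⌊ meets? job V j ⌋ then w j else 0ℚ) ⟩
    Σ (λ j → μ * (if ⌊ meets? job V j ⌋ then w j else 0ℚ))
      ≤⟨ Σ-mono-≤ (λ j → perJob (meets? job V j)) ⟩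
    Σ (λ j → Σ (λ u → if ⌊ job u ≟ j ⌋ then g∣C u else 0ℚ))
      ≡⟨ Σ-fibres job g∣C ⟩
    Σ[ jobClosure job V ] g
      ∎
    where
    open ≤-Reasoning
    g∣C : Fin n → ℚ
    g∣C u = if ⌊ u ∈? jobClosure job V ⌋ then g u else 0ℚ
    perJob : ∀ {j} (d : Dec (∃ λ u → u ∈ V × job u ≡ j)) →
             μ * (if ⌊ d ⌋ then w j else 0ℚ) ≤ Σ (λ u → if ⌊ job u ≟ j ⌋ then g∣C u else 0ℚ)
    perJob {j} (no _) = ≤-trans (≤-reflexive (*-zeroʳ μ))
      (Σ-nonNeg (λ u → if-nonNeg ⌊ job u ≟ j ⌋ (if-nonNeg ⌊ u ∈? jobClosure job V ⌋ (g≥0 u))))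
    perJob (yes (u′ , u′∈V , refl)) = begin
      μ * w (job u′)
        ≡⟨ cong (μ *_) (sym (Σ-wt-job u′)) ⟩
      μ * Σ (λ u → if ⌊ job u ≟ job u′ ⌋ then ω u else 0ℚ)
        ≡⟨ *-distribˡ-Σ μ (λ u → if ⌊ job u ≟ job u′ ⌋ then ω u else 0ℚ) ⟩
      Σ (λ u → μ * (if ⌊ job u ≟ job u′ ⌋ then ω u else 0ℚ))
        ≡⟨ Σ-cong (λ u → *-distribˡ-if ⌊ job u ≟ job u′ ⌋ μ (ω u)) ⟩
      Σ (λ u → if ⌊ job u ≟ job u′ ⌋ then μ * ω u else 0ℚ)
        ≤⟨ Σ-mono-≤ (λ u → if-mono-≤ (job u ≟ job u′) (member u)) ⟩
      Σ (λ u → if ⌊ job u ≟ job u′ ⌋ then g∣C u else 0ℚ)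
        ∎
      where
      ω = wt w job
      member : ∀ u → job u ≡ job u′ → μ * ω u ≤ g∣C u
      member u same = begin
        μ * ω u  ≡⟨ *-comm μ (ω u) ⟩
        ω u * μ  ≤⟨ bound u∈C ⟩
        g u      ≡⟨ sym (if-dec-yes (u ∈? jobClosure job V) u∈C) ⟩
        g∣C u    ∎
        where u∈C = ∈-jobClosure⁺ u′∈V (sym same)

module _ {n J} {w : Fin J → ℚ} {job : Fin n → Fin J} (w>0 : ∀ j → 0ℚ < w j) where

  wt-pos : ∀ u → 0ℚ < wt w job u
  wt-pos u = positive⁻¹ _
    {{pos*pos⇒pos (w (job u)) {{positive (w>0 (job u))}} _ {{normalize-pos 1 _ {{numAlive-nonZero job u}}}}}}

  wt*-monoʳ-≤ : ∀ u {x y} → x ≤ y → wt w job u * x ≤ wt w job u * y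
  wt*-monoʳ-≤ u = *-monoˡ-≤-nonNeg (wt w job u) {{nonNegative (<⇒≤ (wt-pos u))}}

  wSet-nonNeg : ∀ X → 0ℚ ≤ wSet w job X
  wSet-nonNeg X = Σ-nonNeg (λ j → if-nonNeg _ (<⇒≤ (w>0 j)))

  wt*Σ[]rate≤wtSet*rate : (φ : Fin n → ℚ) (v : Fin n) (V : Subset n) → (∀ u → u ∈ V → φ u ≤ φ v) →
                          wt w job v * Σ[ V ] (rate w job φ) ≤ wtSet w job V * rate w job φ v
  wt*Σ[]rate≤wtSet*rate φ v V earlier = begin
    ω v * Σ[ V ] (rate w job φ)          ≡⟨ *-distribˡ-Σ[] V (ω v) (rate w job φ) ⟩
    Σ[ V ] (λ u → ω v * (ω u * φ u))     ≤⟨ Σ[]-mono-≤ V termwise ⟩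
    Σ[ V ] (λ u → rate w job φ v * ω u)  ≡⟨ sym (*-distribˡ-Σ[] V (rate w job φ v) ω) ⟩
    rate w job φ v * wtSet w job V       ≡⟨ *-comm (rate w job φ v) _ ⟩
    wtSet w job V * rate w job φ v       ∎
    where
    open ≤-Reasoning
    ω = wt w job
    termwise : ∀ {u} → u ∈ V → ω v * (ω u * φ u) ≤ (ω v * φ v) * ω u
    termwise {u} u∈V = begin
      ω v * (ω u * φ u)  ≡⟨ x*[y*z]≡y*[x*z] (ω v) (ω u) (φ u) ⟩
      ω u * (ω v * φ u)  ≤⟨ wt*-monoʳ-≤ u (wt*-monoʳ-≤ v (earlier u u∈V)) ⟩
      ω u * (ω v * φ v)  ≡⟨ *-comm (ω u) _ ⟩
      (ω v * φ v) * ω u  ∎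


module _ {m n J} {s : Fin m → ℚ} {w : Fin J → ℚ} {job : Fin n → Fin J} {γ : ℚ} {φ : Fin n → ℚ}
         (speeds : SpeedsOK s) (w>0 : ∀ j → 0ℚ < w j) (γ>0 : 0ℚ < γ) (run : IsRun s w job γ φ) where

  private
    L : ℚ → Fin n → ℚ
    L = rateAt w job φ

    Tight : ℚ → Subset n → Set
    Tight μ X = Σ[ X ] (L μ) ≡ γ * Ssum s ∣ X ∣

    φ≥0 : ∀ u → 0ℚ ≤ φ u
    φ≥0 = proj₁ run

    feasible : ∀ τ → 0ℚ ≤ τ → ∀ X → Σ[ X ] (L τ) ≤ γ * Ssum s ∣ X ∣
    feasible = proj₁ (proj₂ run)

    freezing : ∀ u → ∃ λ X → u ∈ X × Tight (φ u) X
    freezing = proj₂ (proj₂ run)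

    γ*-monoʳ-≤ : ∀ {x y} → x ≤ y → γ * x ≤ γ * y
    γ*-monoʳ-≤ = *-monoˡ-≤-nonNeg γ {{nonNegative (<⇒≤ γ>0)}}

  L-mono : ∀ {μ μ′} → μ ≤ μ′ → ∀ u → L μ u ≤ L μ′ u
  L-mono μ≤μ′ u = wt*-monoʳ-≤ w>0 u (⊓-monoʳ-≤ (φ u) μ≤μ′)

  L-nonNeg : ∀ {μ} → 0ℚ ≤ μ → ∀ u → 0ℚ ≤ L μ u
  L-nonNeg μ≥0 u =
    ≤-trans (≤-reflexive (sym (*-zeroʳ (wt w job u)))) (wt*-monoʳ-≤ w>0 u (⊓-glb (φ≥0 u) μ≥0))

  L-frozen : ∀ {μ u} → φ u ≤ μ → L μ u ≡ rate w job φ u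
  L-frozen {u = u} φu≤μ = cong (wt w job u *_) (p≤q⇒p⊓q≡p φu≤μ)

  L-unfrozen : ∀ {μ u} → μ ≤ φ u → L μ u ≡ wt w job u * μ
  L-unfrozen {u = u} μ≤φu = cong (wt w job u *_) (p≥q⇒p⊓q≡q μ≤φu)

  tight⇒frozen : ∀ {μ X u} → Tight μ X → u ∈ X → φ u ≤ μ
  tight⇒frozen {μ} {X} {u} tight u∈X =
    ≮⇒≥ λ μ<φu → <⇒≱ (overloaded μ<φu) (feasible (φ u) (φ≥0 u) X)
    where
    overloaded : μ < φ u → γ * Ssum s ∣ X ∣ < Σ[ X ] (L (φ u))
    overloaded μ<φu = begin-strict
      γ * Ssum s ∣ X ∣   ≡⟨ sym tight ⟩
      Σ[ X ] (L μ)       <⟨ Σ[]-mono-< u∈X (λ {x} _ → L-mono (<⇒≤ μ<φu) x) Lu-grows ⟩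
      Σ[ X ] (L (φ u))   ∎
      where
      open ≤-Reasoning
      Lu-grows : L μ u < L (φ u) u
      Lu-grows = begin-strict
        L μ u             ≡⟨ L-unfrozen (<⇒≤ μ<φu) ⟩
        wt w job u * μ    <⟨ *-monoʳ-<-pos (wt w job u) {{positive (wt-pos w>0 u)}} μ<φu ⟩
        wt w job u * φ u  ≡⟨ sym (L-frozen ≤-refl) ⟩
        L (φ u) u         ∎

  sameJob⇒¬earlier : ∀ {u u′} → job u ≡ job u′ → ¬ (φ u < φ u′)
  sameJob⇒¬earlier {u} {u′} ju≡ju′ φu<φu′ with freezing u
  ... | X , u∈X , tight = <⇒≱ φu<φu′ (tight⇒frozen tightZ ([]≔-updates (X [ u ]≔ outside) u′))
    where
    u′∉X : u′ ∉ X
    u′∉X u′∈X = <⇒≱ φu<φu′ (tight⇒frozen tight u′∈X)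
    Lu′≡Lu : L (φ u) u′ ≡ L (φ u) u
    Lu′≡Lu = begin
      L (φ u) u′         ≡⟨ L-unfrozen (<⇒≤ φu<φu′) ⟩
      wt w job u′ * φ u  ≡⟨ cong (_* φ u) (wt-sameJob {w = w} {job} (sym ju≡ju′)) ⟩
      wt w job u * φ u   ≡⟨ sym (L-frozen ≤-refl) ⟩
      L (φ u) u          ∎
      where open ≡-Reasoning
    tightZ : Tight (φ u) ((X [ u ]≔ outside) [ u′ ]≔ inside)
    tightZ = trans (Σ[]-exchange (L (φ u)) u∈X u′∉X Lu′≡Lu)
                   (trans tight (cong (λ k → γ * Ssum s k) (sym (∣exchange∣ u∈X u′∉X))))

  sameJob⇒sameMoment : ∀ {u u′} → job u ≡ job u′ → φ u ≡ φ u′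
  sameJob⇒sameMoment ju≡ju′ =
    ≤-antisym (≮⇒≥ (sameJob⇒¬earlier (sym ju≡ju′))) (≮⇒≥ (sameJob⇒¬earlier ju≡ju′))

  γ*spd≤rate : ∀ {τ v} → v ∈ frozenBy φ τ → γ * spd s ∣ frozenBy φ τ ∣ ≤ rate w job φ v
  γ*spd≤rate {τ} {v} v∈F with freezing v
  ... | X , v∈X , tight = ≤-trans (γ*-monoʳ-≤ (spd-antitone speeds |X|≤|F|)) marginal
    where
    Y = X [ v ]≔ outside
    X⊆F : X ⊆ frozenBy φ τ
    X⊆F x∈X = ∈-frozenBy⁺ (≤-trans (tight⇒frozen tight x∈X) (∈-frozenBy⁻ v∈F))
    |X|≤|F| : suc ∣ Y ∣ ℕ.≤ ∣ frozenBy φ τ ∣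
    |X|≤|F| = subst (ℕ._≤ ∣ frozenBy φ τ ∣) (∣erase∣ v∈X) (p⊆q⇒∣p∣≤∣q∣ X⊆F)
    marginal : γ * spd s (suc ∣ Y ∣) ≤ rate w job φ v
    marginal = +-cancelʳ-≤ (γ * Ssum s ∣ Y ∣) (begin
      γ * spd s (suc ∣ Y ∣) + γ * Ssum s ∣ Y ∣  ≡⟨ +-comm (γ * spd s (suc ∣ Y ∣)) _ ⟩
      γ * Ssum s ∣ Y ∣ + γ * spd s (suc ∣ Y ∣)  ≡⟨ sym (*-distribˡ-+ γ (Ssum s ∣ Y ∣) _) ⟩
      γ * Ssum s (suc ∣ Y ∣)                    ≡⟨ cong (λ k → γ * Ssum s k) (sym (∣erase∣ v∈X)) ⟩
      γ * Ssum s ∣ X ∣                          ≡⟨ sym tight ⟩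
      Σ[ X ] (L (φ v))                          ≡⟨ Σ[]-erase (L (φ v)) v∈X ⟩
      L (φ v) v + Σ[ Y ] (L (φ v))              ≤⟨ +-mono-≤ (≤-reflexive (L-frozen ≤-refl))
                                                             (feasible (φ v) (φ≥0 v) Y) ⟩
      rate w job φ v + γ * Ssum s ∣ Y ∣         ∎)
      where open ≤-Reasoning

  wSet*φ≤γ*Ssum : ∀ {τ v} (V′ : Subset n) → v ∈ frozenBy φ τ → V′ ⊆ frozenBy φ τ →
                  (∀ u → u ∈ V′ → φ v ≤ φ u) → wSet w job V′ * φ v ≤ γ * Ssum s ∣ frozenBy φ τ ∣
  wSet*φ≤γ*Ssum {τ} {v} V′ v∈F V′⊆F later = begin
    wSet w job V′ * φ v          ≤⟨ wSet*≤Σ[jobClosure] V′ (φ v) (L τ) (L-nonNeg τ≥0) moment-bound ⟩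
    Σ[ C ] (L τ)                 ≤⟨ feasible τ τ≥0 C ⟩
    γ * Ssum s ∣ C ∣             ≤⟨ γ*-monoʳ-≤ (Ssum-mono speeds (p⊆q⇒∣p∣≤∣q∣ C⊆F)) ⟩
    γ * Ssum s ∣ frozenBy φ τ ∣  ∎
    where
    open ≤-Reasoning
    C = jobClosure job V′
    τ≥0 : 0ℚ ≤ τ
    τ≥0 = ≤-trans (φ≥0 v) (∈-frozenBy⁻ v∈F)
    C⊆F : C ⊆ frozenBy φ τ
    C⊆F u∈C with ∈-jobClosure⁻ u∈C
    ... | u′ , u′∈V′ , same =
      ∈-frozenBy⁺ (subst (_≤ τ) (sameJob⇒sameMoment same) (∈-frozenBy⁻ (V′⊆F u′∈V′)))
    moment-bound : ∀ {u} → u ∈ C → wt w job u * φ v ≤ L τ u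
    moment-bound {u} u∈C with ∈-jobClosure⁻ u∈C
    ... | u′ , u′∈V′ , same = wt*-monoʳ-≤ w>0 u
      (⊓-glb (≤-trans (later u′ u′∈V′) (≤-reflexive (sameJob⇒sameMoment same))) (∈-frozenBy⁻ v∈F))

  wSet*spd≤wt*Ssum : ∀ {τ v} (V′ : Subset n) → v ∈ frozenBy φ τ → V′ ⊆ frozenBy φ τ →
                     (∀ u → u ∈ V′ → φ v ≤ φ u) →
                     wSet w job V′ * spd s ∣ frozenBy φ τ ∣ ≤ wt w job v * Ssum s ∣ frozenBy φ τ ∣
  wSet*spd≤wt*Ssum {τ} {v} V′ v∈F V′⊆F later = *-cancelˡ-≤-pos γ {{positive γ>0}} (begin
    γ * (W * σ)       ≡⟨ x*[y*z]≡y*[x*z] γ W σ ⟩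
    W * (γ * σ)       ≤⟨ *-monoˡ-≤-nonNeg W {{nonNegative (wSet-nonNeg w>0 V′)}} (γ*spd≤rate v∈F) ⟩
    W * (ω v * φ v)   ≡⟨ x*[y*z]≡y*[x*z] W (ω v) (φ v) ⟩
    ω v * (W * φ v)   ≤⟨ wt*-monoʳ-≤ w>0 v (wSet*φ≤γ*Ssum V′ v∈F V′⊆F later) ⟩
    ω v * (γ * S)     ≡⟨ x*[y*z]≡y*[x*z] (ω v) γ S ⟩
    γ * (ω v * S)     ∎)
    where
    open ≤-Reasoning
    W = wSet w job V′
    ω = wt w job
    σ = spd s ∣ frozenBy φ τ ∣
    S = Ssum s ∣ frozenBy φ τ ∣

corollary1 : ∀ {m n J} (s : Fin m → ℚ) (w : Fin J → ℚ) (job : Fin n → Fin J)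
    (γ : ℚ) (φ : Fin n → ℚ) →
    SpeedsOK s → (∀ j → 0ℚ < w j) → 1ℚ ≤ γ → IsRun s w job γ φ →
    ∀ (τ : ℚ) (v : Fin n) → v ∈ frozenBy φ τ →
    (∀ (V′ : Subset n) → V′ ⊆ frozenBy φ τ → (∀ u → u ∈ V′ → φ v ≤ φ u) →
       wSet w job V′ * spd s ∣ frozenBy φ τ ∣ ≤ wt w job v * Ssum s ∣ frozenBy φ τ ∣)
    × (∀ (V″ : Subset n) → V″ ⊆ frozenBy φ τ → (∀ u → u ∈ V″ → φ u ≤ φ v) →
       wt w job v * Σ[ V″ ] (rate w job φ) ≤ wtSet w job V″ * rate w job φ v)
corollary1 s w job γ φ speeds w>0 γ≥1 run τ v v∈F =
    (λ V′ V′⊆F later → wSet*spd≤wt*Ssum speeds w>0 γ>0 run V′ v∈F V′⊆F later)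
  , (λ V″ _ earlier → wt*Σ[]rate≤wtSet*rate w>0 φ v V″ earlier)
  where
  γ>0 : 0ℚ < γ
  γ>0 = <-≤-trans (positive⁻¹ 1ℚ) γ≥1
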